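{- If $(A,\rightarrow,\rightsquigarrow,1)$ is a linearly ordered commutative pseudo-BE algebra, then $\mathcal{IS}^{(I)}(A)\subseteq\mathcal{SMO}(A)$ and $\mathcal{IS}^{(II)}(A)\subseteq\mathcal{SMO}(A)$.
   Context: A pseudo-BE algebra is an algebra $(A,\rightarrow,\rightsquigarrow,1)$ of type $(2,2,0)$ such that for all $x,y,z\in A$: $x\rightarrow x=x\rightsquigarrow x=1$; $x\rightarrow 1=x\rightsquigarrow 1=1$; $1\rightarrow x=1\rightsquigarrow x=x$; $x\rightarrow(y\rightsquigarrow z)=y\rightsquigarrow(x\rightarrow z)$; $x\rightarrow y=1$ iff $x\rightsquigarrow y=1$. Write $x\le y$ iff $x\rightarrow y=1$; linearly ordered means any two elements are comparable. Put $x\vee_1 y=(x\rightarrow y)\rightsquigarrow y$, $x\vee_2 y=(x\rightsquigarrow y)\rightarrow y$; $A$ is commutative if $x\vee_1 y=y\vee_1 x$ and $x\vee_2 y=y\vee_2 x$ for all $x,y$. For $\mu:A\to A$ consider: (is1) $x\le y$ implies $\mu(x)\le\mu(y)$; (is2) $\mu(x\rightarrow y)=\mu(x\vee_1 y)\rightarrow\mu(y)$ and $\mu(x\rightsquigarrow y)=\mu(x\vee_2 y)\rightsquigarrow\mu(y)$; (is2') $\mu(x\rightarrow y)=\mu(y\vee_1 x)\rightarrow\mu(y)$ and $\mu(x\rightsquigarrow y)=\mu(y\vee_2 x)\rightsquigarrow\mu(y)$; (is3) $\mu(\mu(x)\rightarrow\mu(y))=\mu(x)\rightarrow\mu(y)$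 and $\mu(\mu(x)\rightsquigarrow\mu(y))=\mu(x)\rightsquigarrow\mu(y)$. $\mathcal{IS}^{(I)}(A)$: maps satisfying (is1),(is2),(is3); $\mathcal{IS}^{(II)}(A)$: maps satisfying (is1),(is2'),(is3). $\mathcal{SMO}(A)$ is the set of state-morphism operators: maps $\mu:A\to A$ with $\mu(x\rightarrow y)=\mu(x)\rightarrow\mu(y)$, $\mu(x\rightsquigarrow y)=\mu(x)\rightsquigarrow\mu(y)$ for all $x,y$, and $\mu\circ\mu=\mu$. -}

module Defs where

open import Level using (Level; suc)
open import Relation.Binary.PropositionalEquality using (_≡_)
open import Data.Product using (_×_)
open import Data.Sum using (_⊎_)
open import Function using (_∘_)

record PseudoBE (a : Level) : Set (suc a) where
  infixr 5 _⇒_ _⇝_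
  field
    Carrier : Set a
    _⇒_     : Carrier → Carrier → Carrier
    _⇝_     : Carrier → Carrier → Carrier
    one     : Carrier
    ⇒-refl  : ∀ x → x ⇒ x ≡ one
    ⇝-refl  : ∀ x → x ⇝ x ≡ one
    ⇒-one   : ∀ x → x ⇒ one ≡ one
    ⇝-one   : ∀ x → x ⇝ one ≡ one
    one-⇒   : ∀ x → one ⇒ x ≡ x
    one-⇝   : ∀ x → one ⇝ x ≡ x
    exch    : ∀ x y z → x ⇒ (y ⇝ z) ≡ y ⇝ (x ⇒ z)
    ⇒-⇝-one : ∀ x y → (x ⇒ y ≡ one → x ⇝ y ≡ one) × (x ⇝ y ≡ one → x ⇒ y ≡ one)

  _≤_ : Carrier → Carrier → Set a
  x ≤ y = x ⇒ y ≡ one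

  _∨₁_ : Carrier → Carrier → Carrier
  x ∨₁ y = (x ⇒ y) ⇝ y

  _∨₂_ : Carrier → Carrier → Carrier
  x ∨₂ y = (x ⇝ y) ⇒ y

module _ {a : Level} (A : PseudoBE a) where
  open PseudoBE A

  LinearlyOrdered : Set a
  LinearlyOrdered = ∀ x y → x ≤ y ⊎ y ≤ x

  Commutative : Set a
  Commutative = ∀ x y → (x ∨₁ y ≡ y ∨₁ x) × (x ∨₂ y ≡ y ∨₂ x)

  IS1 : (Carrier → Carrier) → Set a
  IS1 μ = ∀ x y → x ≤ y → μ x ≤ μ y

  IS2 : (Carrier → Carrier) → Set a
  IS2 μ = ∀ x y → (μ (x ⇒ y) ≡ μ (x ∨₁ y) ⇒ μ y) × (μ (x ⇝ y) ≡ μ (x ∨₂ y) ⇝ μ y)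

  IS2' : (Carrier → Carrier) → Set a
  IS2' μ = ∀ x y → (μ (x ⇒ y) ≡ μ (y ∨₁ x) ⇒ μ y) × (μ (x ⇝ y) ≡ μ (y ∨₂ x) ⇝ μ y)

  IS3 : (Carrier → Carrier) → Set a
  IS3 μ = ∀ x y → (μ (μ x ⇒ μ y) ≡ μ x ⇒ μ y) × (μ (μ x ⇝ μ y) ≡ μ x ⇝ μ y)

  IsIS-I : (Carrier → Carrier) → Set a
  IsIS-I μ = IS1 μ × IS2 μ × IS3 μ

  IsIS-II : (Carrier → Carrier) → Set a
  IsIS-II μ = IS1 μ × IS2' μ × IS3 μ

  IsSMO : (Carrier → Carrier) → Set a
  IsSMO μ = (∀ x y → (μ (x ⇒ y) ≡ μ x ⇒ μ y) × (μ (x ⇝ y) ≡ μ x ⇝ μ y))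
          × (∀ x → μ (μ x) ≡ μ x)

module Submission where

-- The proof has two independent parts.
--  * Commutativity is only used to pass from type I to type II: since
--    x ∨₁ y = y ∨₁ x and x ∨₂ y = y ∨₂ x, axiom (is2) is literally (is2').
--  * In ANY linearly ordered pseudo-BE algebra, a type II state μ is a
--    state-morphism.  From (is2') one gets μ 1 = 1, and μ (x → y) = μ x → μ y
--    whenever y ≤ x (then y ∨₁ x = x).  When x ≤ y both sides equal 1, by
--    μ 1 = 1 and monotonicity (is1); linearity covers all pairs.  Finally
--    (is3) with x := 1 gives idempotence μ (μ y) = μ y.

open import Defs
open import Level using (Level)
open import Data.Product using (_×_; _,_; proj₁; proj₂)
open import Data.Sum using (inj₁; inj₂)
open import Relation.Binary.PropositionalEquality
open ≡-Reasoning

module _ {a : Level} (A : PseudoBE a) where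
  open PseudoBE A

  ≤-⇝ : ∀ {x y} → x ≤ y → x ⇝ y ≡ one
  ≤-⇝ {x} {y} = proj₁ (⇒-⇝-one x y)

  ∨₁-absorb : ∀ {x y} → x ≤ y → x ∨₁ y ≡ y
  ∨₁-absorb {x} {y} x≤y = trans (cong (_⇝ y) x≤y) (one-⇝ y)

  ∨₂-absorb : ∀ {x y} → x ≤ y → x ∨₂ y ≡ y
  ∨₂-absorb {x} {y} x≤y = trans (cong (_⇒ y) (≤-⇝ x≤y)) (one-⇒ y)

  is2⇒is2' : Commutative A → ∀ μ → IS2 A μ → IS2' A μ
  is2⇒is2' com μ is2 x y =
      trans (proj₁ (is2 x y)) (cong (λ z → μ z ⇒ μ y) (proj₁ (com x y)))
    , trans (proj₂ (is2 x y)) (cong (λ z → μ z ⇝ μ y) (proj₂ (com x y)))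

  module TypeII (μ : Carrier → Carrier) (is2' : IS2' A μ) where

    -- A type II state preserves the top element: take x = y = 1 in (is2').
    μ-one : μ one ≡ one
    μ-one = begin
      μ one                  ≡⟨ cong μ (sym (⇒-refl one)) ⟩
      μ (one ⇒ one)          ≡⟨ proj₁ (is2' one one) ⟩
      μ (one ∨₁ one) ⇒ μ one ≡⟨ cong (λ z → μ z ⇒ μ one) (∨₁-absorb (⇒-refl one)) ⟩
      μ one ⇒ μ one          ≡⟨ ⇒-refl (μ one) ⟩
      one                    ∎

    ⇒-hom-≥ : ∀ {x y} → y ≤ x → μ (x ⇒ y) ≡ μ x ⇒ μ y
    ⇒-hom-≥ {x} {y} y≤x =
      trans (proj₁ (is2' x y)) (cong (λ z → μ z ⇒ μ y) (∨₁-absorb y≤x))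

    ⇝-hom-≥ : ∀ {x y} → y ≤ x → μ (x ⇝ y) ≡ μ x ⇝ μ y
    ⇝-hom-≥ {x} {y} y≤x =
      trans (proj₂ (is2' x y)) (cong (λ z → μ z ⇝ μ y) (∨₂-absorb y≤x))

    -- On pairs with x ≤ y, both sides are 1, by μ 1 = 1 and monotonicity.
    ⇒-hom-≤ : IS1 A μ → ∀ {x y} → x ≤ y → μ (x ⇒ y) ≡ μ x ⇒ μ y
    ⇒-hom-≤ is1 {x} {y} x≤y = begin
      μ (x ⇒ y)  ≡⟨ cong μ x≤y ⟩
      μ one      ≡⟨ μ-one ⟩
      one        ≡⟨ sym (is1 x y x≤y) ⟩
      μ x ⇒ μ y  ∎

    ⇝-hom-≤ : IS1 A μ → ∀ {x y} → x ≤ y → μ (x ⇝ y) ≡ μ x ⇝ μ y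
    ⇝-hom-≤ is1 {x} {y} x≤y = begin
      μ (x ⇝ y)  ≡⟨ cong μ (≤-⇝ x≤y) ⟩
      μ one      ≡⟨ μ-one ⟩
      one        ≡⟨ sym (≤-⇝ (is1 x y x≤y)) ⟩
      μ x ⇝ μ y  ∎

    -- Idempotence: (is3) at x = 1, where μ 1 ⇒ μ y reduces to μ y.
    idempotent : IS3 A μ → ∀ y → μ (μ y) ≡ μ y
    idempotent is3 y = begin
      μ (μ y)              ≡⟨ cong μ (sym top-⇒) ⟩
      μ (μ one ⇒ μ y)      ≡⟨ proj₁ (is3 one y) ⟩
      μ one ⇒ μ y          ≡⟨ top-⇒ ⟩
      μ y                  ∎
      where
      top-⇒ : μ one ⇒ μ y ≡ μ y
      top-⇒ = trans (cong (_⇒ μ y) μ-one) (one-⇒ (μ y))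

  typeII⇒SMO : LinearlyOrdered A → ∀ μ → IsIS-II A μ → IsSMO A μ
  typeII⇒SMO lin μ (is1 , is2' , is3) = hom , idempotent is3
    where
    open TypeII μ is2'
    hom : ∀ x y → (μ (x ⇒ y) ≡ μ x ⇒ μ y) × (μ (x ⇝ y) ≡ μ x ⇝ μ y)
    hom x y with lin x y
    ... | inj₁ x≤y = ⇒-hom-≤ is1 x≤y , ⇝-hom-≤ is1 x≤y
    ... | inj₂ y≤x = ⇒-hom-≥ y≤x , ⇝-hom-≥ y≤x

proposition4p12 : {a : Level} (A : PseudoBE a) → LinearlyOrdered A → Commutative A
    → ((μ : PseudoBE.Carrier A → PseudoBE.Carrier A) → IsIS-I A μ → IsSMO A μ)
    × ((μ : PseudoBE.Carrier A → PseudoBE.Carrier A) → IsIS-II A μ → IsSMO A μ)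
proposition4p12 A lin com = typeI⇒SMO , typeII⇒SMO A lin
  where
  typeI⇒SMO : ∀ μ → IsIS-I A μ → IsSMO A μ
  typeI⇒SMO μ (is1 , is2 , is3) = typeII⇒SMO A lin μ (is1 , is2⇒is2' A com μ is2 , is3)
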